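{- Let $P$ be a finite poset and $A$ any subset of its ground set. For $B\subseteq A$ put $A\downarrow_P B=(A\setminus B)P\cup PB$. Then $$d(P)\le\sum_{B\subseteq A} d\bigl(P-A\downarrow_P B\bigr),$$ and equality holds whenever $A$ is an antichain.
   Context: For a finite poset $P$, $d(P)$ is the number of downsets of $P$ (with $d$ of the empty poset equal to $1$). For a subset $S$ of the ground set, $PS=\{x\mid x\le_P s\text{ for some } s\in S\}$ is the down-closure and $SP=\{x\mid s\le_P x\text{ for some } s\in S\}$ the up-closure; $P-S$ denotes the subposet induced on the complement of $S$. -}

module Defs where

open import Data.Nat using (ℕ; zero; suc)
open import Data.Bool using (Bool; true; false)
open import Data.Fin using (Fin)
open import Data.Fin.Subset using (Subset; _∈_; _∉_; _⊆_; _∪_; _─_; ∁; inside; outside)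
open import Data.Fin.Subset.Properties using (_∈?_; _⊆?_)
open import Data.Fin.Properties using (any?; all?)
open import Data.List using (List; []; _∷_; _++_; map; filter; length)
open import Data.Nat.ListAction using (sum)
open import Data.Vec using (Vec; []; _∷_; tabulate)
open import Data.Product using (_×_; ∃)
open import Relation.Binary using (IsPartialOrder; Decidable)
open import Relation.Binary.PropositionalEquality using (_≡_)
open import Relation.Nullary using (Dec; ¬_)
open import Relation.Nullary.Decidable using (⌊_⌋; _×-dec_; _→-dec_)

record FinPoset (n : ℕ) : Set₁ where
  field
    _⊑_            : Fin n → Fin n → Set
    isPartialOrder : IsPartialOrder _≡_ _⊑_
    _⊑?_           : Decidable _⊑_

open FinPoset public

allSubsets : (n : ℕ) → List (Subset n)
allSubsets zero    = [] ∷ []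
allSubsets (suc n) = map (outside ∷_) (allSubsets n) ++ map (inside ∷_) (allSubsets n)

module _ {n : ℕ} (P : FinPoset n) where
  private
    _≤P_ = _⊑_ P
    _≤P?_ = _⊑?_ P

  IsDownsetOf : Subset n → Subset n → Set
  IsDownsetOf U S = S ⊆ U × (∀ x y → x ∈ U → y ∈ S → x ≤P y → x ∈ S)

  isDownsetOf? : (U S : Subset n) → Dec (IsDownsetOf U S)
  isDownsetOf? U S =
    (S ⊆? U) ×-dec
    all? (λ x → all? (λ y →
      (x ∈? U) →-dec ((y ∈? S) →-dec ((x ≤P? y) →-dec (x ∈? S)))))

  -- d(P - S): number of downsets of the subposet induced on the complement of S.
  dMinus : Subset n → ℕ
  dMinus S = length (filter (isDownsetOf? (∁ S)) (allSubsets n))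

  d : ℕ
  d = length (filter (isDownsetOf? (Data.Fin.Subset.⊤)) (allSubsets n))

  -- PS = {x | x ≤ s for some s ∈ S}
  downClosure : Subset n → Subset n
  downClosure S = tabulate (λ x → ⌊ any? (λ s → (s ∈? S) ×-dec (x ≤P? s)) ⌋)

  -- SP = {x | s ≤ x for some s ∈ S}
  upClosure : Subset n → Subset n
  upClosure S = tabulate (λ x → ⌊ any? (λ s → (s ∈? S) ×-dec (s ≤P? x)) ⌋)

  arrow : Subset n → Subset n → Subset n
  arrow A B = upClosure (A ─ B) ∪ downClosure B

  sumOverSubsets : Subset n → ℕ
  sumOverSubsets A = sum (map (λ B → dMinus (arrow A B)) (filter (_⊆? A) (allSubsets n)))

  IsAntichain : Subset n → Set
  IsAntichain A = ∀ x y → x ∈ A → y ∈ A → x ≤P y → x ≡ y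

{-# OPTIONS --safe #-}
module Submission where

-- A downset D of P is recorded by B = D ∩ A ⊆ A and E = D ∖ PB.  E avoids (A ∖ B)P,
-- since D is down-closed and misses A ∖ B, and E avoids PB by construction, so E is a
-- downset of P − A↓B; D is recovered as E ∪ PB.  This injects the downsets of P into
-- the pairs counted by the sum.  When A is an antichain, (E ∪ PB) ∩ A = B for every
-- such pair, so the injection is also surjective.

open import Defs
open import Data.Nat using (ℕ; zero; _≤_; suc; z≤n; s≤s; _+_)
open import Data.Nat.Properties using (≤-antisym)
open import Data.Bool.Properties using (T-≡)
open import Data.Fin using (Fin)
open import Data.Fin.Properties using (any?)
open import Data.Fin.Subset using (Subset; _∈_; _∉_; _⊆_; _∪_; _∩_; _─_; ∁; ⊤; inside; outside)
open import Data.Fin.Subset.Properties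
  using (_∈?_; _⊆?_; ⊆⊤; ∈⊤; ⊆-antisym; x∈p∩q⁺; x∈p∩q⁻; p∩q⊆p; p∩q⊆q; p⊆p∪q; q⊆p∪q; x∈p∪q⁺; x∈p∪q⁻; x∈∁p⇒x∉p; x∉p⇒x∈∁p)
open import Data.Vec using ([]; _∷_; tabulate)
open import Data.Vec.Properties using (lookup∘tabulate; []=⇒lookup; lookup⇒[]=)
open import Data.List using (List; []; _∷_; _++_; map; filter; length)
open import Data.List.Properties using (length-++; length-map; length-removeAt′)
open import Data.Nat.ListAction using (sum)
open import Data.List.Relation.Unary.Any using (here; there; index)
import Data.List.Relation.Unary.Any as Any
import Data.List.Relation.Unary.All as All
open import Data.List.Relation.Unary.AllPairs using (_∷_; [])
open import Data.List.Membership.Propositional using () renaming (_∈_ to _∈ᴸ_)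
open import Data.List.Membership.Propositional.Properties
  using (∈-map⁺; ∈-map⁻; ∈-++⁺ˡ; ∈-++⁺ʳ; ∈-++⁻; ∈-filter⁺; ∈-filter⁻)
open import Data.List.Relation.Unary.Unique.Propositional using (Unique)
import Data.List.Relation.Unary.Unique.Propositional.Properties as Unique
open import Data.Product using (_×_; _,_; proj₁; proj₂; ∃)
open import Data.Sum using (inj₁; inj₂)
open import Data.Empty using (⊥; ⊥-elim)
open import Function using (_∘_; Equivalence)
open import Relation.Binary using (IsPartialOrder)
open import Relation.Binary.PropositionalEquality using (_≡_; _≢_; refl; sym; trans; cong; cong₂; subst; module ≡-Reasoning)
open import Relation.Nullary using (yes; no)
open import Relation.Nullary.Decidable using (⌊_⌋; _×-dec_; isYes≗does; dec-true; toWitness)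
import Relation.Unary as U

∈-─⁺ : ∀ {Y : Set} {x y : Y} {ys : List Y} (p : y ∈ᴸ ys) → x ∈ᴸ ys → x ≢ y → x ∈ᴸ (ys Any.─ p)
∈-─⁺ (here refl) (here refl) x≢y = ⊥-elim (x≢y refl)
∈-─⁺ (here refl) (there q)   _   = q
∈-─⁺ (there p)   (here refl) _   = here refl
∈-─⁺ (there p)   (there q)   x≢y = there (∈-─⁺ p q x≢y)

length-≤-retraction : ∀ {X Y : Set} (f : X → Y) (g : Y → X) {xs : List X} {ys : List Y} →
  Unique xs → (∀ {x} → x ∈ᴸ xs → f x ∈ᴸ ys) → (∀ {x} → x ∈ᴸ xs → g (f x) ≡ x) →
  length xs ≤ length ys
length-≤-retraction f g {[]} _ _ _ = z≤n
length-≤-retraction f g {x ∷ xs} {ys} (x∉xs ∷ xs!) into retract =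
  subst (suc (length xs) ≤_) (sym (length-removeAt′ ys (index fx∈ys)))
    (s≤s (length-≤-retraction f g xs! into′ (retract ∘ there)))
  where
  fx∈ys = into (here refl)
  f-injective : ∀ {x′} → x′ ∈ᴸ xs → f x ≡ f x′ → x ≡ x′
  f-injective p e = trans (sym (retract (here refl))) (trans (cong g e) (retract (there p)))
  into′ : ∀ {x′} → x′ ∈ᴸ xs → f x′ ∈ᴸ (ys Any.─ fx∈ys)
  into′ p = ∈-─⁺ fx∈ys (into (there p)) (All.lookup x∉xs p ∘ f-injective p ∘ sym)

module _ {X Y : Set} (f : X → List Y) where

  sigmaList : List X → List (X × Y)
  sigmaList []       = []
  sigmaList (x ∷ xs) = map (x ,_) (f x) ++ sigmaList xs

  length-sigmaList : ∀ xs → length (sigmaList xs) ≡ sum (map (length ∘ f) xs)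
  length-sigmaList []       = refl
  length-sigmaList (x ∷ xs) =
    trans (length-++ (map (x ,_) (f x))) (cong₂ _+_ (length-map (x ,_) (f x)) (length-sigmaList xs))

  ∈-sigmaList⁺ : ∀ {xs x y} → x ∈ᴸ xs → y ∈ᴸ f x → (x , y) ∈ᴸ sigmaList xs
  ∈-sigmaList⁺ {x′ ∷ xs} (here refl) y∈ = ∈-++⁺ˡ (∈-map⁺ (x′ ,_) y∈)
  ∈-sigmaList⁺ {x′ ∷ xs} (there x∈)  y∈ = ∈-++⁺ʳ (map (x′ ,_) (f x′)) (∈-sigmaList⁺ x∈ y∈)

  ∈-sigmaList⁻ : ∀ {xs x y} → (x , y) ∈ᴸ sigmaList xs → x ∈ᴸ xs × y ∈ᴸ f x
  ∈-sigmaList⁻ {x′ ∷ xs} p with ∈-++⁻ (map (x′ ,_) (f x′)) p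
  ... | inj₁ q with ∈-map⁻ (x′ ,_) q
  ...   | _ , y∈ , refl = here refl , y∈
  ∈-sigmaList⁻ {x′ ∷ xs} p | inj₂ q with ∈-sigmaList⁻ {xs} q
  ...   | x∈ , y∈ = there x∈ , y∈

  sigmaList-unique : ∀ {xs} → Unique xs → (∀ x → Unique (f x)) → Unique (sigmaList xs)
  sigmaList-unique {[]}     _           _  = []
  sigmaList-unique {x ∷ xs} (x∉xs ∷ xs!) f! =
    Unique.++⁺ (Unique.map⁺ (cong proj₂) (f! x)) (sigmaList-unique xs! f!) disjoint
    where
    disjoint : ∀ {v} → (v ∈ᴸ map (x ,_) (f x)) × (v ∈ᴸ sigmaList xs) → ⊥
    disjoint (p , q) with ∈-map⁻ (x ,_) p
    ... | _ , _ , refl = All.lookup x∉xs (proj₁ (∈-sigmaList⁻ q)) refl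

∈-allSubsets : ∀ {n} (S : Subset n) → S ∈ᴸ allSubsets n
∈-allSubsets []                    = here refl
∈-allSubsets {suc n} (outside ∷ S) = ∈-++⁺ˡ (∈-map⁺ (outside ∷_) (∈-allSubsets S))
∈-allSubsets {suc n} (inside ∷ S)  =
  ∈-++⁺ʳ (map (outside ∷_) (allSubsets n)) (∈-map⁺ (inside ∷_) (∈-allSubsets S))

allSubsets-unique : ∀ n → Unique (allSubsets n)
allSubsets-unique zero  = All.[] ∷ []
allSubsets-unique (suc n) =
  Unique.++⁺ (Unique.map⁺ tail-injective (allSubsets-unique n))
             (Unique.map⁺ tail-injective (allSubsets-unique n)) disjoint
  where
  tail-injective : ∀ {s} {S T : Subset n} → s ∷ S ≡ s ∷ T → S ≡ T
  tail-injective refl = refl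
  disjoint : ∀ {S} → (S ∈ᴸ map (outside ∷_) (allSubsets n)) × (S ∈ᴸ map (inside ∷_) (allSubsets n)) → ⊥
  disjoint (p , q) with ∈-map⁻ (outside ∷_) p | ∈-map⁻ (inside ∷_) q
  ... | _ , _ , refl | _ , _ , ()

module _ {n : ℕ} {Q : Subset n → Set} (Q? : U.Decidable Q) where

  ∈-filter-allSubsets⁺ : ∀ {S} → Q S → S ∈ᴸ filter Q? (allSubsets n)
  ∈-filter-allSubsets⁺ = ∈-filter⁺ Q? (∈-allSubsets _)

  ∈-filter-allSubsets⁻ : ∀ {S} → S ∈ᴸ filter Q? (allSubsets n) → Q S
  ∈-filter-allSubsets⁻ = proj₂ ∘ ∈-filter⁻ Q? {xs = allSubsets n}

  filter-allSubsets-unique : Unique (filter Q? (allSubsets n))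
  filter-allSubsets-unique = Unique.filter⁺ Q? (allSubsets-unique n)

p─q≡p∩∁q : ∀ {n} (p q : Subset n) → p ─ q ≡ p ∩ ∁ q
p─q≡p∩∁q []            []            = refl
p─q≡p∩∁q (outside ∷ p) (outside ∷ q) = cong (outside ∷_) (p─q≡p∩∁q p q)
p─q≡p∩∁q (outside ∷ p) (inside  ∷ q) = cong (outside ∷_) (p─q≡p∩∁q p q)
p─q≡p∩∁q (inside  ∷ p) (outside ∷ q) = cong (inside ∷_) (p─q≡p∩∁q p q)
p─q≡p∩∁q (inside  ∷ p) (inside  ∷ q) = cong (outside ∷_) (p─q≡p∩∁q p q)

module _ {n : ℕ} {x : Fin n} where

  x∈p─q⁺ : ∀ {p q : Subset n} → x ∈ p → x ∉ q → x ∈ p ─ q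
  x∈p─q⁺ {p} {q} x∈p x∉q = subst (x ∈_) (sym (p─q≡p∩∁q p q)) (x∈p∩q⁺ (x∈p , x∉p⇒x∈∁p x∉q))

  x∈p─q⁻ : ∀ (p q : Subset n) → x ∈ p ─ q → x ∈ p × x ∉ q
  x∈p─q⁻ p q x∈p─q with x∈p∩q⁻ p (∁ q) (subst (x ∈_) (p─q≡p∩∁q p q) x∈p─q)
  ... | x∈p , x∈∁q = x∈p , x∈∁p⇒x∉p x∈∁q

  x∈tabulate⁺ : ∀ {Q : Fin n → Set} (Q? : U.Decidable Q) → Q x → x ∈ tabulate (⌊_⌋ ∘ Q?)
  x∈tabulate⁺ Q? qx = lookup⇒[]= x _
    (trans (lookup∘tabulate (⌊_⌋ ∘ Q?) x) (trans (isYes≗does (Q? x)) (dec-true (Q? x) qx)))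

  x∈tabulate⁻ : ∀ {Q : Fin n → Set} (Q? : U.Decidable Q) → x ∈ tabulate (⌊_⌋ ∘ Q?) → Q x
  x∈tabulate⁻ Q? x∈ =
    toWitness (Equivalence.from T-≡ (trans (sym (lookup∘tabulate (⌊_⌋ ∘ Q?) x)) ([]=⇒lookup x∈)))

p─q∪q≡p : ∀ {n} {p q : Subset n} → q ⊆ p → (p ─ q) ∪ q ≡ p
p─q∪q≡p {p = p} {q} q⊆p = ⊆-antisym ⊆p p⊆
  where
  ⊆p : (p ─ q) ∪ q ⊆ p
  ⊆p x∈ with x∈p∪q⁻ (p ─ q) q x∈
  ... | inj₁ x∈p─q = proj₁ (x∈p─q⁻ p q x∈p─q)
  ... | inj₂ x∈q   = q⊆p x∈q
  p⊆ : p ⊆ (p ─ q) ∪ q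
  p⊆ {x} x∈p with x ∈? q
  ... | yes x∈q = x∈p∪q⁺ (inj₂ x∈q)
  ... | no  x∉q = x∈p∪q⁺ (inj₁ (x∈p─q⁺ x∈p x∉q))

p∪q─q≡p : ∀ {n} {p q : Subset n} → (∀ {x} → x ∈ p → x ∉ q) → (p ∪ q) ─ q ≡ p
p∪q─q≡p {p = p} {q} p-disjoint-q = ⊆-antisym ⊆p p⊆
  where
  ⊆p : (p ∪ q) ─ q ⊆ p
  ⊆p x∈ with x∈p─q⁻ (p ∪ q) q x∈
  ... | x∈p∪q , x∉q with x∈p∪q⁻ p q x∈p∪q
  ...   | inj₁ x∈p = x∈p
  ...   | inj₂ x∈q = ⊥-elim (x∉q x∈q)
  p⊆ : p ⊆ (p ∪ q) ─ q
  p⊆ x∈p = x∈p─q⁺ (x∈p∪q⁺ (inj₁ x∈p)) (p-disjoint-q x∈p)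

module _ {n : ℕ} (P : FinPoset n) where
  private
    _≼_ = _⊑_ P
  open IsPartialOrder (isPartialOrder P) using () renaming (refl to ≼-refl; trans to ≼-trans)

  IsDownset : Subset n → Set
  IsDownset = IsDownsetOf P ⊤

  downsetsOf : Subset n → List (Subset n)
  downsetsOf U = filter (isDownsetOf? P U) (allSubsets n)

  module _ {S : Subset n} {x : Fin n} where

    ∈-downClosure⁺ : ∀ {s} → s ∈ S → x ≼ s → x ∈ downClosure P S
    ∈-downClosure⁺ s∈S x≼s = x∈tabulate⁺ (λ y → any? (λ s → (s ∈? S) ×-dec (_⊑?_ P y s))) (_ , s∈S , x≼s)

    ∈-downClosure⁻ : x ∈ downClosure P S → ∃ λ s → s ∈ S × x ≼ s
    ∈-downClosure⁻ = x∈tabulate⁻ (λ y → any? (λ s → (s ∈? S) ×-dec (_⊑?_ P y s)))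

    ∈-upClosure⁺ : ∀ {s} → s ∈ S → s ≼ x → x ∈ upClosure P S
    ∈-upClosure⁺ s∈S s≼x = x∈tabulate⁺ (λ y → any? (λ s → (s ∈? S) ×-dec (_⊑?_ P s y))) (_ , s∈S , s≼x)

    ∈-upClosure⁻ : x ∈ upClosure P S → ∃ λ s → s ∈ S × s ≼ x
    ∈-upClosure⁻ = x∈tabulate⁻ (λ y → any? (λ s → (s ∈? S) ×-dec (_⊑?_ P s y)))

  ⊆-downClosure : ∀ {S} → S ⊆ downClosure P S
  ⊆-downClosure s∈S = ∈-downClosure⁺ s∈S ≼-refl

  downClosure-least : ∀ {S D} → IsDownset D → S ⊆ D → downClosure P S ⊆ D
  downClosure-least {D = D} (_ , D-closed) S⊆D x∈ with ∈-downClosure⁻ x∈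
  ... | s , s∈S , x≼s = D-closed _ s ∈⊤ (S⊆D s∈S) x≼s

  module _ (A : Subset n) where

    upClosure⊆arrow : ∀ B → upClosure P (A ─ B) ⊆ arrow P A B
    upClosure⊆arrow B = p⊆p∪q (downClosure P B)

    downClosure⊆arrow : ∀ B → downClosure P B ⊆ arrow P A B
    downClosure⊆arrow B = q⊆p∪q (upClosure P (A ─ B)) (downClosure P B)

    split : Subset n → Subset n × Subset n
    split D = D ∩ A , D ─ downClosure P (D ∩ A)

    glue : Subset n × Subset n → Subset n
    glue (B , E) = E ∪ downClosure P B

    split-isDownset : ∀ {D} → IsDownset D → IsDownsetOf P (∁ (arrow P A (D ∩ A))) (proj₂ (split D))
    split-isDownset {D} (_ , D-closed) = E⊆∁arrow , E-closed
      where
      B = D ∩ A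
      E⊆∁arrow : D ─ downClosure P B ⊆ ∁ (arrow P A B)
      E⊆∁arrow {x} x∈E with x∈p─q⁻ D (downClosure P B) x∈E
      ... | x∈D , x∉PB = x∉p⇒x∈∁p x∉arrow
        where
        x∉arrow : x ∉ arrow P A B
        x∉arrow x∈arrow with x∈p∪q⁻ (upClosure P (A ─ B)) (downClosure P B) x∈arrow
        ... | inj₂ x∈PB = x∉PB x∈PB
        ... | inj₁ x∈up with ∈-upClosure⁻ x∈up
        ...   | s , s∈A─B , s≼x with x∈p─q⁻ A B s∈A─B
        ...     | s∈A , s∉B = s∉B (x∈p∩q⁺ (D-closed s x ∈⊤ x∈D s≼x , s∈A))
      E-closed : ∀ x y → x ∈ ∁ (arrow P A B) → y ∈ D ─ downClosure P B → x ≼ y → x ∈ D ─ downClosure P B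
      E-closed x y x∈∁arrow y∈E x≼y =
        x∈p─q⁺ (D-closed x y ∈⊤ (proj₁ (x∈p─q⁻ D _ y∈E)) x≼y)
               (x∈∁p⇒x∉p x∈∁arrow ∘ downClosure⊆arrow B)

    glue-isDownset : ∀ {B E} → IsDownsetOf P (∁ (arrow P A B)) E → IsDownset (glue (B , E))
    glue-isDownset {B} {E} (E⊆∁arrow , E-closed) = ⊆⊤ , closed
      where
      closed : ∀ x y → x ∈ ⊤ → y ∈ E ∪ downClosure P B → x ≼ y → x ∈ E ∪ downClosure P B
      closed x y _ y∈glue x≼y with x∈p∪q⁻ E (downClosure P B) y∈glue
      ... | inj₂ y∈PB with ∈-downClosure⁻ y∈PB
      ...   | s , s∈B , y≼s = x∈p∪q⁺ (inj₂ (∈-downClosure⁺ s∈B (≼-trans x≼y y≼s)))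
      closed x y _ y∈glue x≼y | inj₁ y∈E with x ∈? arrow P A B
      ...   | no x∉arrow = x∈p∪q⁺ (inj₁ (E-closed x y (x∉p⇒x∈∁p x∉arrow) y∈E x≼y))
      ...   | yes x∈arrow with x∈p∪q⁻ (upClosure P (A ─ B)) (downClosure P B) x∈arrow
      ...     | inj₂ x∈PB = x∈p∪q⁺ (inj₂ x∈PB)
      ...     | inj₁ x∈up with ∈-upClosure⁻ x∈up
      ...       | s , s∈A─B , s≼x =
        ⊥-elim (x∈∁p⇒x∉p (E⊆∁arrow y∈E) (upClosure⊆arrow B (∈-upClosure⁺ s∈A─B (≼-trans s≼x x≼y))))

    glue∘split : ∀ {D} → IsDownset D → glue (split D) ≡ D
    glue∘split D-downset = p─q∪q≡p (downClosure-least D-downset (p∩q⊆p _ A))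

    module _ (A-antichain : IsAntichain P A) {B E : Subset n} (B⊆A : B ⊆ A)
             (E-downset : IsDownsetOf P (∁ (arrow P A B)) E) where

      private
        E-avoids-arrow : ∀ {x} → x ∈ E → x ∉ arrow P A B
        E-avoids-arrow x∈E = x∈∁p⇒x∉p (proj₁ E-downset x∈E)

      glue∩A≡B : glue (B , E) ∩ A ≡ B
      glue∩A≡B = ⊆-antisym ⊆B B⊆
        where
        ⊆B : glue (B , E) ∩ A ⊆ B
        ⊆B {x} x∈ with x∈p∩q⁻ (glue (B , E)) A x∈
        ... | x∈glue , x∈A with x∈p∪q⁻ E (downClosure P B) x∈glue
        ...   | inj₂ x∈PB with ∈-downClosure⁻ x∈PB
        ...     | s , s∈B , x≼s = subst (_∈ B) (sym (A-antichain x s x∈A (B⊆A s∈B) x≼s)) s∈B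
        ⊆B {x} x∈ | x∈glue , x∈A | inj₁ x∈E with x ∈? B
        ...     | yes x∈B = x∈B
        ...     | no  x∉B =
          ⊥-elim (E-avoids-arrow x∈E (upClosure⊆arrow B (∈-upClosure⁺ (x∈p─q⁺ x∈A x∉B) ≼-refl)))
        B⊆ : B ⊆ glue (B , E) ∩ A
        B⊆ x∈B = x∈p∩q⁺ (x∈p∪q⁺ (inj₂ (⊆-downClosure x∈B)) , B⊆A x∈B)

      split∘glue : split (glue (B , E)) ≡ (B , E)
      split∘glue = cong₂ _,_ glue∩A≡B (begin
        glue (B , E) ─ downClosure P (glue (B , E) ∩ A) ≡⟨ cong (λ B′ → glue (B , E) ─ downClosure P B′) glue∩A≡B ⟩
        (E ∪ downClosure P B) ─ downClosure P B         ≡⟨ p∪q─q≡p (λ x∈E → E-avoids-arrow x∈E ∘ downClosure⊆arrow B) ⟩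
        E                                               ∎)
        where open ≡-Reasoning

    subsetsOfA : List (Subset n)
    subsetsOfA = filter (_⊆? A) (allSubsets n)

    downsetsAvoidingArrow : Subset n → List (Subset n)
    downsetsAvoidingArrow B = downsetsOf (∁ (arrow P A B))

    labelledDownsets : List (Subset n × Subset n)
    labelledDownsets = sigmaList downsetsAvoidingArrow subsetsOfA

    length-labelledDownsets : length labelledDownsets ≡ sumOverSubsets P A
    length-labelledDownsets = length-sigmaList downsetsAvoidingArrow subsetsOfA

    d≤sumOverSubsets : d P ≤ sumOverSubsets P A
    d≤sumOverSubsets = subst (d P ≤_) length-labelledDownsets
      (length-≤-retraction split glue (filter-allSubsets-unique _) into (glue∘split ∘ ∈-filter-allSubsets⁻ _))
      where
      into : ∀ {D} → D ∈ᴸ downsetsOf ⊤ → split D ∈ᴸ labelledDownsets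
      into {D} D∈ = ∈-sigmaList⁺ downsetsAvoidingArrow
        (∈-filter-allSubsets⁺ (_⊆? A) (p∩q⊆q D A))
        (∈-filter-allSubsets⁺ _ (split-isDownset (∈-filter-allSubsets⁻ _ D∈)))

    sumOverSubsets≤d : IsAntichain P A → sumOverSubsets P A ≤ d P
    sumOverSubsets≤d A-antichain = subst (_≤ d P) length-labelledDownsets
      (length-≤-retraction glue split labelledDownsets-unique into retract)
      where
      labelledDownsets-unique : Unique labelledDownsets
      labelledDownsets-unique = sigmaList-unique downsetsAvoidingArrow
        (filter-allSubsets-unique _) (λ _ → filter-allSubsets-unique _)
      into : ∀ {BE} → BE ∈ᴸ labelledDownsets → glue BE ∈ᴸ downsetsOf ⊤
      into {B , E} BE∈ = ∈-filter-allSubsets⁺ _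
        (glue-isDownset (∈-filter-allSubsets⁻ _ (proj₂ (∈-sigmaList⁻ downsetsAvoidingArrow {subsetsOfA} BE∈))))
      retract : ∀ {BE} → BE ∈ᴸ labelledDownsets → split (glue BE) ≡ BE
      retract {B , E} BE∈ with ∈-sigmaList⁻ downsetsAvoidingArrow {subsetsOfA} BE∈
      ... | B∈ , E∈ = split∘glue A-antichain (∈-filter-allSubsets⁻ _ B∈) (∈-filter-allSubsets⁻ _ E∈)

theorem3p1 : (n : ℕ) (P : FinPoset n) (A : Subset n) →
    (d P ≤ sumOverSubsets P A) × (IsAntichain P A → d P ≡ sumOverSubsets P A)
theorem3p1 n P A =
  d≤sumOverSubsets P A , λ A-antichain → ≤-antisym (d≤sumOverSubsets P A) (sumOverSubsets≤d P A A-antichain)
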